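{- For every nonnegative integer $n$, $$\sum_{k=0}^n\binom{2k}k^3\binom k{n-k}(-16)^{n-k}=\sum_{k=0}^n\binom{2k}k^2\binom{2(n-k)}{n-k}^2.$$
   Context: $\binom{k}{j}=0$ when $j>k$. -}

module Defs where

open import Data.Nat using (ℕ; zero; suc)
open import Data.Integer using (ℤ; _+_)

sumTo : ℕ → (ℕ → ℤ) → ℤ
sumTo zero f = f zero
sumTo (suc n) f = sumTo n f + f (suc n)

-- Both sides u n satisfy the recurrence
--   256 (n+1)³ u n − 8 (2n+3)(2n²+6n+5) u (n+1) + (n+2)³ u (n+2) = 0
-- and agree at n = 0 and n = 1. For the left side this is creative
-- telescoping: the recurrence applied to the k-th summand is G (k+1) − G k,
-- where G k is −(n+2) k² times the k-th summand at n+2. For the right side,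
-- with m = n − j and b i the square of the i-th central binomial coefficient,
-- (m+1)² times the partial sum over k ≤ j of the recurrence applied to the
-- summands is 4 (j+1)² b (j+1) b m (4m² + 4mj + 9m + 3j + 4), by induction on j.
-- Each of these facts becomes a polynomial identity once the relations between
-- consecutive (central) binomial coefficients are used to clear denominators.
module Submission where

open import Defs
open import Data.Nat using (ℕ; _∸_)
open import Data.Nat.Combinatorics using (_C_)
open import Data.Integer using (ℤ; +_; -_; _*_; _^_)
open import Relation.Binary.PropositionalEquality using (_≡_)

open import Agda.Builtin.FromNat using (Number; fromNat)
open import Agda.Builtin.FromNeg using (Negative; fromNeg)
open import Algebra.Bundles using (AbelianGroup)
open import Data.Nat as ℕ using (zero; suc; _≤_)
open import Data.Nat.Combinatorics using (nCk+nC[k+1]≡[n+1]C[k+1]; nC1≡n; nCk≡nC[n∸k])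
import Data.Nat.Properties as ℕP
import Data.Nat.Tactic.RingSolver as ℕSolver
open import Data.Integer using (_+_; _-_; NonZero)
import Data.Integer.Literals as ℤ
import Data.Nat.Literals as ℕ
import Data.Integer.Properties as ℤP
open import Data.Integer.Tactic.RingSolver using (solve-∀)
open import Data.Unit.Base using (tt)
open import Data.Product using (_×_; _,_; proj₁)
open import Relation.Binary.PropositionalEquality
  using (refl; sym; trans; cong; cong₂; subst; module ≡-Reasoning)

open import Algebra.Properties.Group (AbelianGroup.group ℤP.+-0-abelianGroup)
  using (∙-cancelˡ)

instance
  ℕ-number : Number ℕ
  ℕ-number = ℕ.number

  ℤ-number : Number ℤ
  ℤ-number = ℤ.number

  ℤ-negative : Negative ℤ
  ℤ-negative = ℤ.negative

[k+1]*nC[k+1]+k*nCk≡n*nCk : ∀ n k → suc k ℕ.* (n C suc k) ℕ.+ k ℕ.* (n C k) ≡ n ℕ.* (n C k)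
[k+1]*nC[k+1]+k*nCk≡n*nCk n zero = begin
  1 ℕ.* (n C 1) ℕ.+ 0  ≡⟨ ℕP.+-identityʳ _ ⟩
  1 ℕ.* (n C 1)        ≡⟨ ℕP.*-identityˡ _ ⟩
  n C 1                ≡⟨ nC1≡n n ⟩
  n                    ≡⟨ ℕP.*-identityʳ n ⟨
  n ℕ.* 1              ∎
  where open ≡-Reasoning
[k+1]*nC[k+1]+k*nCk≡n*nCk zero (suc k) = cong₂ ℕ._+_ (ℕP.*-zeroʳ (suc (suc k))) (ℕP.*-zeroʳ (suc k))
[k+1]*nC[k+1]+k*nCk≡n*nCk (suc n) (suc k) = begin
  (2 ℕ.+ k) ℕ.* (suc n C (2 ℕ.+ k)) ℕ.+ suc k ℕ.* (suc n C suc k)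
    ≡⟨ cong₂ (λ y z → (2 ℕ.+ k) ℕ.* y ℕ.+ suc k ℕ.* z) (pascal (suc k)) (pascal k) ⟨
  (2 ℕ.+ k) ℕ.* (n C suc k ℕ.+ n C (2 ℕ.+ k)) ℕ.+ suc k ℕ.* (n C k ℕ.+ n C suc k)
    ≡⟨ regroup k (n C k) (n C suc k) (n C (2 ℕ.+ k)) ⟩
  ((2 ℕ.+ k) ℕ.* (n C (2 ℕ.+ k)) ℕ.+ suc k ℕ.* (n C suc k))
    ℕ.+ (suc k ℕ.* (n C suc k) ℕ.+ k ℕ.* (n C k)) ℕ.+ (n C k ℕ.+ n C suc k)
    ≡⟨ cong₂ (λ y z → y ℕ.+ z ℕ.+ (n C k ℕ.+ n C suc k))
         ([k+1]*nC[k+1]+k*nCk≡n*nCk n (suc k)) ([k+1]*nC[k+1]+k*nCk≡n*nCk n k) ⟩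
  n ℕ.* (n C suc k) ℕ.+ n ℕ.* (n C k) ℕ.+ (n C k ℕ.+ n C suc k)
    ≡⟨ collect n (n C k) (n C suc k) ⟩
  suc n ℕ.* (n C k ℕ.+ n C suc k)
    ≡⟨ cong (suc n ℕ.*_) (pascal k) ⟩
  suc n ℕ.* (suc n C suc k)
    ∎
  where
  open ≡-Reasoning
  pascal : ∀ k → n C k ℕ.+ n C suc k ≡ suc n C suc k
  pascal = nCk+nC[k+1]≡[n+1]C[k+1] n
  regroup : ∀ k x y z → (2 ℕ.+ k) ℕ.* (y ℕ.+ z) ℕ.+ suc k ℕ.* (x ℕ.+ y)
    ≡ ((2 ℕ.+ k) ℕ.* z ℕ.+ suc k ℕ.* y) ℕ.+ (suc k ℕ.* y ℕ.+ k ℕ.* x) ℕ.+ (x ℕ.+ y)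
  regroup = ℕSolver.solve-∀
  collect : ∀ n x y → n ℕ.* y ℕ.+ n ℕ.* x ℕ.+ (x ℕ.+ y) ≡ suc n ℕ.* (x ℕ.+ y)
  collect = ℕSolver.solve-∀

[k+1]*[n+1]C[k+1]≡[n+1]*nCk : ∀ n k → suc k ℕ.* (suc n C suc k) ≡ suc n ℕ.* (n C k)
[k+1]*[n+1]C[k+1]≡[n+1]*nCk n k = ℕP.+-cancelʳ-≡ (k ℕ.* (n C k)) _ _ (begin
  suc k ℕ.* (suc n C suc k) ℕ.+ k ℕ.* (n C k)
    ≡⟨ cong (λ z → suc k ℕ.* z ℕ.+ k ℕ.* (n C k)) (nCk+nC[k+1]≡[n+1]C[k+1] n k) ⟨
  suc k ℕ.* (n C k ℕ.+ n C suc k) ℕ.+ k ℕ.* (n C k)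
    ≡⟨ regroup k (n C k) (n C suc k) ⟩
  (suc k ℕ.* (n C suc k) ℕ.+ k ℕ.* (n C k)) ℕ.+ suc k ℕ.* (n C k)
    ≡⟨ cong (ℕ._+ suc k ℕ.* (n C k)) ([k+1]*nC[k+1]+k*nCk≡n*nCk n k) ⟩
  n ℕ.* (n C k) ℕ.+ suc k ℕ.* (n C k)
    ≡⟨ collect n k (n C k) ⟩
  suc n ℕ.* (n C k) ℕ.+ k ℕ.* (n C k)
    ∎)
  where
  open ≡-Reasoning
  regroup : ∀ k x y →
    suc k ℕ.* (x ℕ.+ y) ℕ.+ k ℕ.* x ≡ (suc k ℕ.* y ℕ.+ k ℕ.* x) ℕ.+ suc k ℕ.* x
  regroup = ℕSolver.solve-∀
  collect : ∀ n k x → n ℕ.* x ℕ.+ suc k ℕ.* x ≡ suc n ℕ.* x ℕ.+ k ℕ.* x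
  collect = ℕSolver.solve-∀

binomial-recurrenceℤ : ∀ k t → (1 + + t) * + (k C suc t) + + t * + (k C t) ≡ + k * + (k C t)
binomial-recurrenceℤ k t = begin
  + suc t * + (k C suc t) + + t * + (k C t)
    ≡⟨ cong₂ _+_ (ℤP.pos-* (suc t) (k C suc t)) (ℤP.pos-* t (k C t)) ⟨
  + (suc t ℕ.* (k C suc t) ℕ.+ t ℕ.* (k C t))
    ≡⟨ cong +_ ([k+1]*nC[k+1]+k*nCk≡n*nCk k t) ⟩
  + (k ℕ.* (k C t))
    ≡⟨ ℤP.pos-* k (k C t) ⟩
  + k * + (k C t)
    ∎
  where open ≡-Reasoning

central : ℕ → ℕ
central m = (2 ℕ.* m) C m

central-recurrence : ∀ m → suc m ℕ.* central (suc m) ≡ 2 ℕ.* suc (2 ℕ.* m) ℕ.* central m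
central-recurrence m = begin
  suc m ℕ.* ((2 ℕ.* suc m) C suc m)
    ≡⟨ cong (λ n → suc m ℕ.* (n C suc m)) (ℕP.*-suc 2 m) ⟩
  suc m ℕ.* (suc (suc (2 ℕ.* m)) C suc m)
    ≡⟨ [k+1]*[n+1]C[k+1]≡[n+1]*nCk (suc (2 ℕ.* m)) m ⟩
  suc (suc (2 ℕ.* m)) ℕ.* (suc (2 ℕ.* m) C m)
    ≡⟨ double m (suc (2 ℕ.* m) C m) ⟩
  2 ℕ.* (suc m ℕ.* (suc (2 ℕ.* m) C m))
    ≡⟨ cong (λ z → 2 ℕ.* (suc m ℕ.* z)) symmetric ⟩
  2 ℕ.* (suc m ℕ.* (suc (2 ℕ.* m) C suc m))
    ≡⟨ cong (2 ℕ.*_) ([k+1]*[n+1]C[k+1]≡[n+1]*nCk (2 ℕ.* m) m) ⟩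
  2 ℕ.* (suc (2 ℕ.* m) ℕ.* central m)
    ≡⟨ ℕP.*-assoc 2 (suc (2 ℕ.* m)) (central m) ⟨
  2 ℕ.* suc (2 ℕ.* m) ℕ.* central m
    ∎
  where
  open ≡-Reasoning
  double : ∀ m x → suc (suc (2 ℕ.* m)) ℕ.* x ≡ 2 ℕ.* (suc m ℕ.* x)
  double = ℕSolver.solve-∀
  split : ∀ m → suc (2 ℕ.* m) ≡ m ℕ.+ suc m
  split = ℕSolver.solve-∀
  symmetric : suc (2 ℕ.* m) C m ≡ suc (2 ℕ.* m) C suc m
  symmetric = trans (nCk≡nC[n∸k] (ℕP.m≤n⇒m≤1+n (ℕP.m≤m+n m (m ℕ.+ 0))))
                    (cong (suc (2 ℕ.* m) C_) (trans (cong (ℕ._∸ m) (split m)) (ℕP.m+n∸m≡n m (suc m))))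

central-recurrenceℤ : ∀ m → (1 + + m) * + central (suc m) ≡ 2 * (1 + 2 * + m) * + central m
central-recurrenceℤ m = begin
  + suc m * + central (suc m)                  ≡⟨ ℤP.pos-* (suc m) (central (suc m)) ⟨
  + (suc m ℕ.* central (suc m))                ≡⟨ cong +_ (central-recurrence m) ⟩
  + (2 ℕ.* suc (2 ℕ.* m) ℕ.* central m)        ≡⟨ ℤP.pos-* (2 ℕ.* suc (2 ℕ.* m)) (central m) ⟩
  + (2 ℕ.* suc (2 ℕ.* m)) * + central m        ≡⟨ cong (_* + central m) (ℤP.pos-* 2 (suc (2 ℕ.* m))) ⟩
  2 * (1 + + (2 ℕ.* m)) * + central m          ≡⟨ cong (λ x → 2 * (1 + x) * + central m) (ℤP.pos-* 2 m) ⟩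
  2 * (1 + 2 * + m) * + central m              ∎
  where open ≡-Reasoning

square-*≡* : ∀ {u x v y : ℤ} → u * x ≡ v * y → u * u * x ^ 2 ≡ v * v * y ^ 2
square-*≡* {u} {x} {v} {y} e = begin
  u * u * x ^ 2        ≡⟨ regroup u x ⟩
  (u * x) * (u * x)    ≡⟨ cong (λ z → z * z) e ⟩
  (v * y) * (v * y)    ≡⟨ regroup v y ⟨
  v * v * y ^ 2        ∎
  where
  open ≡-Reasoning
  regroup : ∀ u x → u * u * (x * (x * 1)) ≡ (u * x) * (u * x)
  regroup = solve-∀

cube-*≡* : ∀ {u x v y : ℤ} → u * x ≡ v * y → u * u * u * x ^ 3 ≡ v * v * v * y ^ 3
cube-*≡* {u} {x} {v} {y} e = begin
  u * u * u * x ^ 3                ≡⟨ regroup u x ⟩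
  (u * x) * (u * x) * (u * x)      ≡⟨ cong (λ z → z * z * z) e ⟩
  (v * y) * (v * y) * (v * y)      ≡⟨ regroup v y ⟨
  v * v * v * y ^ 3                ∎
  where
  open ≡-Reasoning
  regroup : ∀ u x → u * u * u * (x * (x * (x * 1))) ≡ (u * x) * (u * x) * (u * x)
  regroup = solve-∀

central² central³ : ℕ → ℤ
central² k = (+ central k) ^ 2
central³ k = (+ central k) ^ 3

central²-recurrence : ∀ m →
  (1 + + m) * (1 + + m) * central² (suc m) ≡ (2 * (1 + 2 * + m)) * (2 * (1 + 2 * + m)) * central² m
central²-recurrence m =
  square-*≡* {1 + + m} {+ central (suc m)} {2 * (1 + 2 * + m)} {+ central m} (central-recurrenceℤ m)

central³-recurrence : ∀ m →
  (1 + + m) * (1 + + m) * (1 + + m) * central³ (suc m)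
    ≡ (2 * (1 + 2 * + m)) * (2 * (1 + 2 * + m)) * (2 * (1 + 2 * + m)) * central³ m
central³-recurrence m =
  cube-*≡* {1 + + m} {+ central (suc m)} {2 * (1 + 2 * + m)} {+ central m} (central-recurrenceℤ m)

sumTo-cong : ∀ n {f g : ℕ → ℤ} → (∀ {k} → k ≤ n → f k ≡ g k) → sumTo n f ≡ sumTo n g
sumTo-cong zero    f≗g = f≗g ℕ.z≤n
sumTo-cong (suc n) f≗g =
  cong₂ _+_ (sumTo-cong n (λ k≤n → f≗g (ℕP.m≤n⇒m≤1+n k≤n))) (f≗g ℕP.≤-refl)

sumTo-distrib-+ : ∀ n (f g : ℕ → ℤ) → sumTo n (λ k → f k + g k) ≡ sumTo n f + sumTo n g
sumTo-distrib-+ zero    f g = refl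
sumTo-distrib-+ (suc n) f g =
  trans (cong (_+ (f (suc n) + g (suc n))) (sumTo-distrib-+ n f g))
        (interchange (sumTo n f) (sumTo n g) (f (suc n)) (g (suc n)))
  where
  interchange : ∀ a b c d → (a + b) + (c + d) ≡ (a + c) + (b + d)
  interchange = solve-∀

sumTo-*-distribˡ : ∀ n a (f : ℕ → ℤ) → sumTo n (λ k → a * f k) ≡ a * sumTo n f
sumTo-*-distribˡ zero    a f = refl
sumTo-*-distribˡ (suc n) a f =
  trans (cong (_+ a * f (suc n)) (sumTo-*-distribˡ n a f)) (sym (ℤP.*-distribˡ-+ a _ _))

sumTo-telescope : ∀ n (G : ℕ → ℤ) → sumTo n (λ k → G (suc k) - G k) ≡ G (suc n) - G 0
sumTo-telescope zero    G = refl
sumTo-telescope (suc n) G =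
  trans (cong (_+ (G (2 ℕ.+ n) - G (suc n))) (sumTo-telescope n G))
        (chain (G 0) (G (suc n)) (G (2 ℕ.+ n)))
  where
  chain : ∀ a b c → (b - a) + (c - b) ≡ c - a
  chain = solve-∀

-- The recurrence

-- INLINE lets the ring solver see through these polynomials.
P₀ P₁ P₂ : ℤ → ℤ
P₀ N = 256 * ((1 + N) * (1 + N) * (1 + N))
P₁ N = -8 * ((3 + 2 * N) * (5 + 6 * N + 2 * (N * N)))
P₂ N = (2 + N) * (2 + N) * (2 + N)
{-# INLINE P₀ #-}
{-# INLINE P₁ #-}
{-# INLINE P₂ #-}

ℒ : (ℕ → ℤ) → ℕ → ℤ
ℒ f n = P₀ (+ n) * f n + P₁ (+ n) * f (suc n) + P₂ (+ n) * f (2 ℕ.+ n)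

ℒ-unique : ∀ {f g : ℕ → ℤ} → (∀ n → ℒ f n ≡ 0) → (∀ n → ℒ g n ≡ 0) →
           f 0 ≡ g 0 → f 1 ≡ g 1 → ∀ n → f n ≡ g n
ℒ-unique {f} {g} ℒf≡0 ℒg≡0 f0≡g0 f1≡g1 n = proj₁ (agree n)
  where
  agree : ∀ n → f n ≡ g n × f (suc n) ≡ g (suc n)
  agree zero    = f0≡g0 , f1≡g1
  agree (suc n) with agree n
  ... | fn≡gn , fn+1≡gn+1 = fn+1≡gn+1 ,
    ℤP.*-cancelˡ-≡ (P₂ (+ n)) _ _ (∙-cancelˡ (P₀ (+ n) * g n + P₁ (+ n) * g (suc n)) _ _ (begin
      P₀ (+ n) * g n + P₁ (+ n) * g (suc n) + P₂ (+ n) * f (2 ℕ.+ n)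
        ≡⟨ cong₂ (λ x y → P₀ (+ n) * x + P₁ (+ n) * y + P₂ (+ n) * f (2 ℕ.+ n)) fn≡gn fn+1≡gn+1 ⟨
      ℒ f n  ≡⟨ trans (ℒf≡0 n) (sym (ℒg≡0 n)) ⟩
      ℒ g n  ∎))
    where open ≡-Reasoning

ℒ-sumTo : ∀ (F : ℕ → ℕ → ℤ) n →
  ℒ (λ m → sumTo m (F m)) n
    ≡ sumTo n (λ k → ℒ (λ m → F m k) n)
      + P₁ (+ n) * F (suc n) (suc n)
      + P₂ (+ n) * (F (2 ℕ.+ n) (suc n) + F (2 ℕ.+ n) (2 ℕ.+ n))
ℒ-sumTo F n = trans (regroup p₀ p₁ p₂ (Σ n) (Σ (suc n)) (Σ (2 ℕ.+ n)) x y z)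
                    (cong (λ s → s + p₁ * x + p₂ * (y + z)) (sym termwise))
  where
  open ≡-Reasoning
  p₀ p₁ p₂ x y z : ℤ
  p₀ = P₀ (+ n)
  p₁ = P₁ (+ n)
  p₂ = P₂ (+ n)
  x = F (suc n) (suc n)
  y = F (2 ℕ.+ n) (suc n)
  z = F (2 ℕ.+ n) (2 ℕ.+ n)
  Σ : ℕ → ℤ
  Σ m = sumTo n (F m)
  regroup : ∀ p₀ p₁ p₂ s₀ s₁ s₂ x y z →
    p₀ * s₀ + p₁ * (s₁ + x) + p₂ * ((s₂ + y) + z)
      ≡ (p₀ * s₀ + p₁ * s₁ + p₂ * s₂) + p₁ * x + p₂ * (y + z)
  regroup = solve-∀
  termwise : sumTo n (λ k → ℒ (λ m → F m k) n)
             ≡ p₀ * sumTo n (F n) + p₁ * sumTo n (F (suc n)) + p₂ * sumTo n (F (2 ℕ.+ n))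
  termwise = begin
    sumTo n (λ k → p₀ * F n k + p₁ * F (suc n) k + p₂ * F (2 ℕ.+ n) k)
      ≡⟨ sumTo-distrib-+ n _ _ ⟩
    sumTo n (λ k → p₀ * F n k + p₁ * F (suc n) k) + sumTo n (λ k → p₂ * F (2 ℕ.+ n) k)
      ≡⟨ cong (_+ sumTo n (λ k → p₂ * F (2 ℕ.+ n) k)) (sumTo-distrib-+ n _ _) ⟩
    sumTo n (λ k → p₀ * F n k) + sumTo n (λ k → p₁ * F (suc n) k) + sumTo n (λ k → p₂ * F (2 ℕ.+ n) k)
      ≡⟨ cong₂ _+_ (cong₂ _+_ (sumTo-*-distribˡ n p₀ _) (sumTo-*-distribˡ n p₁ _))
                   (sumTo-*-distribˡ n p₂ _) ⟩
    p₀ * sumTo n (F n) + p₁ * sumTo n (F (suc n)) + p₂ * sumTo n (F (2 ℕ.+ n))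
      ∎

d*[x-y]≡0⇒x≡y : ∀ d .{{_ : NonZero d}} {x y} → d * (x - y) ≡ 0 → x ≡ y
d*[x-y]≡0⇒x≡y d {x} {y} e =
  ℤP.i-j≡0⇒i≡j x y (ℤP.*-cancelˡ-≡ d (x - y) 0 (trans e (sym (ℤP.*-zeroʳ d))))

x≡y⇒q*[x-y]≡0 : ∀ q {x y : ℤ} → x ≡ y → q * (x - y) ≡ 0
x≡y⇒q*[x-y]≡0 q x≡y = trans (cong (q *_) (ℤP.i≡j⇒i-j≡0 x≡y)) (ℤP.*-zeroʳ q)

-- The left-hand side

lhsTerm : ℕ → ℕ → ℤ
lhsTerm n k = central³ k * + (k C (n ∸ k)) * -16 ^ (n ∸ k)

lhs : ℕ → ℤ
lhs n = sumTo n (lhsTerm n)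

lhsTerm-at : ∀ {n k t} → n ∸ k ≡ t → lhsTerm n k ≡ central³ k * + (k C t) * -16 ^ t
lhsTerm-at {k = k} = cong (λ t → central³ k * + (k C t) * -16 ^ t)

lhsCertificate : ℕ → ℕ → ℤ
lhsCertificate n k = - (2 + + n) * (+ k * + k) * lhsTerm (2 ℕ.+ n) k

lhs-telescoping-identity :
  ∀ (k t : ℕ) {x₀ x₁ x₂ y} (aₖ aₖ₊₁ cₜ cₜ₊₁ cₜ₊₂ w : ℤ) →
  let K = + k
      T = + t
      N = T + K
  in x₀ ≡ aₖ * cₜ * w → x₁ ≡ aₖ * cₜ₊₁ * (-16 * w) → x₂ ≡ aₖ * cₜ₊₂ * (-16 * (-16 * w)) →
     y ≡ aₖ₊₁ * (cₜ + cₜ₊₁) * (-16 * w) →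
     (1 + T) * cₜ₊₁ + T * cₜ ≡ K * cₜ →
     (2 + T) * cₜ₊₂ + (1 + T) * cₜ₊₁ ≡ K * cₜ₊₁ →
     (1 + K) * (1 + K) * (1 + K) * aₖ₊₁
       ≡ (2 * (1 + 2 * K)) * (2 * (1 + 2 * K)) * (2 * (1 + 2 * K)) * aₖ →
     P₀ N * x₀ + P₁ N * x₁ + P₂ N * x₂
       ≡ - (2 + N) * ((1 + K) * (1 + K)) * y - - (2 + N) * (K * K) * x₂
lhs-telescoping-identity k t aₖ aₖ₊₁ cₜ cₜ₊₁ cₜ₊₂ w refl refl refl refl h₁ h₂ h₃ =
  d*[x-y]≡0⇒x≡y ((1 + K) * ((1 + T) * (2 + T)))
    (trans (certificate K T aₖ aₖ₊₁ cₜ cₜ₊₁ cₜ₊₂ w)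
           (cong₂ _+_ (cong₂ _+_ (x≡y⇒q*[x-y]≡0 (q₁ K T aₖ w) h₁)
                                 (x≡y⇒q*[x-y]≡0 (q₂ K T aₖ w) h₂))
                      (x≡y⇒q*[x-y]≡0 (q₃ K T cₜ cₜ₊₁ w) h₃)))
  where
  K T : ℤ
  K = + k
  T = + t
  -- The multipliers eliminate cₜ₊₂, cₜ₊₁ and aₖ₊₁ in favour of cₜ and aₖ.
  q₁ q₂ : ℤ → ℤ → ℤ → ℤ → ℤ
  q₁ K T aₖ w = w * aₖ * (-16 * P₁ (T + K) * (1 + K) * (2 + T)
                          + 256 * (P₂ (T + K) - (2 + (T + K)) * (K * K)) * (1 + K) * (K - T - 1)
                          - 16 * (2 + (T + K))
                            * ((2 * (1 + 2 * K)) * (2 * (1 + 2 * K)) * (2 * (1 + 2 * K))) * (2 + T))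
  q₂ K T aₖ w = w * aₖ * (256 * (P₂ (T + K) - (2 + (T + K)) * (K * K))) * (1 + K) * (1 + T)
  q₃ : ℤ → ℤ → ℤ → ℤ → ℤ → ℤ
  q₃ K T cₜ cₜ₊₁ w = -16 * w * (2 + (T + K)) * ((1 + T) * (2 + T)) * (cₜ + cₜ₊₁)
  {-# INLINE q₁ #-}
  {-# INLINE q₂ #-}
  {-# INLINE q₃ #-}
  certificate : ∀ K T aₖ aₖ₊₁ cₜ cₜ₊₁ cₜ₊₂ w →
    (1 + K) * ((1 + T) * (2 + T))
      * ((P₀ (T + K) * (aₖ * cₜ * w) + P₁ (T + K) * (aₖ * cₜ₊₁ * (-16 * w))
          + P₂ (T + K) * (aₖ * cₜ₊₂ * (-16 * (-16 * w))))
        - (- (2 + (T + K)) * ((1 + K) * (1 + K)) * (aₖ₊₁ * (cₜ + cₜ₊₁) * (-16 * w))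
           - - (2 + (T + K)) * (K * K) * (aₖ * cₜ₊₂ * (-16 * (-16 * w)))))
    ≡ q₁ K T aₖ w * ((1 + T) * cₜ₊₁ + T * cₜ - K * cₜ)
      + q₂ K T aₖ w * ((2 + T) * cₜ₊₂ + (1 + T) * cₜ₊₁ - K * cₜ₊₁)
      + q₃ K T cₜ cₜ₊₁ w * ((1 + K) * (1 + K) * (1 + K) * aₖ₊₁
                            - (2 * (1 + 2 * K)) * (2 * (1 + 2 * K)) * (2 * (1 + 2 * K)) * aₖ)
  certificate = solve-∀

lhsTerm-telescopes : ∀ {n k} → k ≤ n →
  ℒ (λ m → lhsTerm m k) n ≡ lhsCertificate n (suc k) - lhsCertificate n k
lhsTerm-telescopes {n} {k} k≤n =
  subst (λ n → ℒ (λ m → lhsTerm m k) n ≡ lhsCertificate n (suc k) - lhsCertificate n k)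
        (ℕP.m∸n+n≡m k≤n) (at (n ∸ k))
  where
  at : ∀ t → ℒ (λ m → lhsTerm m k) (t ℕ.+ k)
             ≡ lhsCertificate (t ℕ.+ k) (suc k) - lhsCertificate (t ℕ.+ k) k
  at t = lhs-telescoping-identity k t
    (central³ k) (central³ (suc k)) (+ (k C t)) (+ (k C suc t)) (+ (k C (2 ℕ.+ t))) (-16 ^ t)
    (lhsTerm-at {t ℕ.+ k} {k} (ℕP.m+n∸n≡m t k))
    (lhsTerm-at {suc t ℕ.+ k} {k} (ℕP.m+n∸n≡m (suc t) k))
    (lhsTerm-at {2 ℕ.+ t ℕ.+ k} {k} (ℕP.m+n∸n≡m (2 ℕ.+ t) k))
    (trans (lhsTerm-at {2 ℕ.+ (t ℕ.+ k)} {suc k} (ℕP.m+n∸n≡m (suc t) k))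
           (cong (λ c → central³ (suc k) * + c * -16 ^ suc t) (sym (nCk+nC[k+1]≡[n+1]C[k+1] k t))))
    (binomial-recurrenceℤ k t)
    (binomial-recurrenceℤ k (suc t))
    (central³-recurrence k)

lhs-boundary-identity :
  ∀ (n : ℕ) {g₀ x₁ y x₃} (aₙ₊₁ aₙ₊₂ : ℤ) →
  let N = + n
  in x₁ ≡ aₙ₊₁ * 1 * 1 → y ≡ aₙ₊₁ * (1 + N) * (-16 * 1) → x₃ ≡ aₙ₊₂ * 1 * 1 →
     (2 + N) * (2 + N) * (2 + N) * aₙ₊₂
       ≡ (2 * (1 + 2 * (1 + N))) * (2 * (1 + 2 * (1 + N))) * (2 * (1 + 2 * (1 + N))) * aₙ₊₁ →
     (- (2 + N) * ((1 + N) * (1 + N)) * y - - (2 + N) * (0 * 0) * g₀) + P₁ N * x₁ + P₂ N * (y + x₃) ≡ 0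
lhs-boundary-identity n {g₀} aₙ₊₁ aₙ₊₂ refl refl refl sₙ₊₁ =
  trans (certificate (+ n) g₀ aₙ₊₁ aₙ₊₂) (ℤP.i≡j⇒i-j≡0 sₙ₊₁)
  where
  certificate : ∀ N g₀ aₙ₊₁ aₙ₊₂ →
    (- (2 + N) * ((1 + N) * (1 + N)) * (aₙ₊₁ * (1 + N) * (-16 * 1)) - - (2 + N) * (0 * 0) * g₀)
      + P₁ N * (aₙ₊₁ * 1 * 1) + P₂ N * (aₙ₊₁ * (1 + N) * (-16 * 1) + aₙ₊₂ * 1 * 1)
    ≡ (2 + N) * (2 + N) * (2 + N) * aₙ₊₂
      - (2 * (1 + 2 * (1 + N))) * (2 * (1 + 2 * (1 + N))) * (2 * (1 + 2 * (1 + N))) * aₙ₊₁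
  certificate = solve-∀

ℒ-lhs : ∀ n → ℒ lhs n ≡ 0
ℒ-lhs n = begin
  ℒ lhs n
    ≡⟨ ℒ-sumTo lhsTerm n ⟩
  sumTo n (λ k → ℒ (λ m → lhsTerm m k) n) + P₁ (+ n) * lhsTerm (suc n) (suc n)
    + P₂ (+ n) * (lhsTerm (2 ℕ.+ n) (suc n) + lhsTerm (2 ℕ.+ n) (2 ℕ.+ n))
    ≡⟨ cong (λ s → s + P₁ (+ n) * lhsTerm (suc n) (suc n)
                     + P₂ (+ n) * (lhsTerm (2 ℕ.+ n) (suc n) + lhsTerm (2 ℕ.+ n) (2 ℕ.+ n)))
            (trans (sumTo-cong n lhsTerm-telescopes) (sumTo-telescope n (lhsCertificate n))) ⟩
  (lhsCertificate n (suc n) - lhsCertificate n 0) + P₁ (+ n) * lhsTerm (suc n) (suc n)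
    + P₂ (+ n) * (lhsTerm (2 ℕ.+ n) (suc n) + lhsTerm (2 ℕ.+ n) (2 ℕ.+ n))
    ≡⟨ lhs-boundary-identity n (central³ (suc n)) (central³ (2 ℕ.+ n))
         (lhsTerm-at {suc n} {suc n} (ℕP.n∸n≡0 n))
         (trans (lhsTerm-at {2 ℕ.+ n} {suc n} (ℕP.m+n∸n≡m 1 n))
                (cong (λ c → central³ (suc n) * + c * -16 ^ 1) (nC1≡n (suc n))))
         (lhsTerm-at {2 ℕ.+ n} {2 ℕ.+ n} (ℕP.n∸n≡0 n))
         (central³-recurrence (suc n)) ⟩
  0 ∎
  where open ≡-Reasoning

-- The right-hand side

rhsTerm : ℕ → ℕ → ℤ
rhsTerm n k = central² k * central² (n ∸ k)

rhs : ℕ → ℤ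
rhs n = sumTo n (rhsTerm n)

rhsTerm-at : ∀ {n k m} → n ∸ k ≡ m → rhsTerm n k ≡ central² k * central² m
rhsTerm-at {k = k} = cong (λ m → central² k * central² m)

rhsPartial : ℕ → ℕ → ℤ
rhsPartial n j = sumTo j (λ k → ℒ (λ m → rhsTerm m k) n)

ρ : ℤ → ℤ → ℤ
ρ M J = 4 * M * M + 4 * M * J + 9 * M + 3 * J + 4
{-# INLINE ρ #-}

rhsPartial-step :
  ∀ (m : ℕ) (J : ℤ) {S bⱼ₊₁ bⱼ₊₂ bₘ bₘ₊₁ bₘ₊₂ x₀ x₁ x₂ : ℤ} →
  let M = + m
      N = M + (1 + J)
  in x₀ ≡ bⱼ₊₁ * bₘ → x₁ ≡ bⱼ₊₁ * bₘ₊₁ → x₂ ≡ bⱼ₊₁ * bₘ₊₂ →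
     (2 + M) * (2 + M) * S ≡ 4 * ((1 + J) * (1 + J)) * (bⱼ₊₁ * bₘ₊₁) * ρ (1 + M) J →
     (2 + M) * (2 + M) * bₘ₊₂ ≡ (2 * (1 + 2 * (1 + M))) * (2 * (1 + 2 * (1 + M))) * bₘ₊₁ →
     (1 + M) * (1 + M) * bₘ₊₁ ≡ (2 * (1 + 2 * M)) * (2 * (1 + 2 * M)) * bₘ →
     (1 + (1 + J)) * (1 + (1 + J)) * bⱼ₊₂
       ≡ (2 * (1 + 2 * (1 + J))) * (2 * (1 + 2 * (1 + J))) * bⱼ₊₁ →
     (1 + M) * (1 + M) * (S + (P₀ N * x₀ + P₁ N * x₁ + P₂ N * x₂))
       ≡ 4 * ((1 + (1 + J)) * (1 + (1 + J))) * (bⱼ₊₂ * bₘ) * ρ M (1 + J)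
rhsPartial-step m J {S} {bⱼ₊₁} {bⱼ₊₂} {bₘ} {bₘ₊₁} {bₘ₊₂} refl refl refl ih sₘ₊₁ sₘ sⱼ₊₁ =
  d*[x-y]≡0⇒x≡y ((2 + M) * (2 + M))
    (trans (certificate M J S bⱼ₊₁ bⱼ₊₂ bₘ bₘ₊₁ bₘ₊₂)
           (cong₂ _+_ (cong₂ _+_ (cong₂ _+_ (x≡y⇒q*[x-y]≡0 ((1 + M) * (1 + M)) ih)
                                             (x≡y⇒q*[x-y]≡0 (qₘ₊₁ M J bⱼ₊₁) sₘ₊₁))
                                 (x≡y⇒q*[x-y]≡0 (qₘ M J bⱼ₊₁) sₘ))
                      (x≡y⇒q*[x-y]≡0 (qⱼ₊₁ M J bₘ) sⱼ₊₁)))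
  where
  M : ℤ
  M = + m
  -- The multipliers eliminate S, bₘ₊₂, bₘ₊₁ and bⱼ₊₂ in favour of bⱼ₊₁ and bₘ.
  qₘ₊₁ qₘ qⱼ₊₁ : ℤ → ℤ → ℤ → ℤ
  qₘ₊₁ M J bⱼ₊₁ = (1 + M) * (1 + M) * P₂ (M + (1 + J)) * bⱼ₊₁
  qₘ M J bⱼ₊₁ = (4 * ((1 + J) * (1 + J)) * ρ (1 + M) J
                 + P₂ (M + (1 + J)) * ((2 * (1 + 2 * (1 + M))) * (2 * (1 + 2 * (1 + M))))
                 + P₁ (M + (1 + J)) * ((2 + M) * (2 + M))) * bⱼ₊₁
  qⱼ₊₁ M J bₘ = -4 * ρ M (1 + J) * ((2 + M) * (2 + M)) * bₘ
  {-# INLINE qₘ₊₁ #-}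
  {-# INLINE qₘ #-}
  {-# INLINE qⱼ₊₁ #-}
  certificate : ∀ M J S bⱼ₊₁ bⱼ₊₂ bₘ bₘ₊₁ bₘ₊₂ →
    (2 + M) * (2 + M)
      * ((1 + M) * (1 + M)
           * (S + (P₀ (M + (1 + J)) * (bⱼ₊₁ * bₘ) + P₁ (M + (1 + J)) * (bⱼ₊₁ * bₘ₊₁)
                   + P₂ (M + (1 + J)) * (bⱼ₊₁ * bₘ₊₂)))
         - 4 * ((1 + (1 + J)) * (1 + (1 + J))) * (bⱼ₊₂ * bₘ) * ρ M (1 + J))
    ≡ (1 + M) * (1 + M)
        * ((2 + M) * (2 + M) * S - 4 * ((1 + J) * (1 + J)) * (bⱼ₊₁ * bₘ₊₁) * ρ (1 + M) J)
      + qₘ₊₁ M J bⱼ₊₁ * ((2 + M) * (2 + M) * bₘ₊₂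
                         - (2 * (1 + 2 * (1 + M))) * (2 * (1 + 2 * (1 + M))) * bₘ₊₁)
      + qₘ M J bⱼ₊₁ * ((1 + M) * (1 + M) * bₘ₊₁ - (2 * (1 + 2 * M)) * (2 * (1 + 2 * M)) * bₘ)
      + qⱼ₊₁ M J bₘ * ((1 + (1 + J)) * (1 + (1 + J)) * bⱼ₊₂
                       - (2 * (1 + 2 * (1 + J))) * (2 * (1 + 2 * (1 + J))) * bⱼ₊₁)
  certificate = solve-∀

-- The closed form at j = −1 is that of the empty sum, so the case j = 0 is
-- an instance of the inductive step.
rhsPartial-closed : ∀ m j →
  (1 + + m) * (1 + + m) * rhsPartial (m ℕ.+ j) j
    ≡ 4 * ((1 + + j) * (1 + + j)) * (central² (suc j) * central² m) * ρ (+ m) (+ j)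
rhsPartial-closed m zero =
  trans (cong ((1 + + m) * (1 + + m) *_) (sym (ℤP.+-identityˡ _)))
        (rhsPartial-step m -1 {0} {central² 0} {central² 1}
          (rhsTerm-at {m ℕ.+ 0} {0} (ℕP.m+n∸n≡m m 0))
          (rhsTerm-at {suc m ℕ.+ 0} {0} (ℕP.m+n∸n≡m (suc m) 0))
          (rhsTerm-at {2 ℕ.+ m ℕ.+ 0} {0} (ℕP.m+n∸n≡m (2 ℕ.+ m) 0))
          (ℤP.*-zeroʳ ((2 + + m) * (2 + + m)))
          (central²-recurrence (suc m))
          (central²-recurrence m)
          refl)
rhsPartial-closed m (suc j) =
  rhsPartial-step m (+ j)
    (rhsTerm-at {m ℕ.+ suc j} {suc j} (ℕP.m+n∸n≡m m (suc j)))
    (rhsTerm-at {suc m ℕ.+ suc j} {suc j} (ℕP.m+n∸n≡m (suc m) (suc j)))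
    (rhsTerm-at {2 ℕ.+ m ℕ.+ suc j} {suc j} (ℕP.m+n∸n≡m (2 ℕ.+ m) (suc j)))
    (subst (λ n → (2 + + m) * (2 + + m) * rhsPartial n j
                    ≡ 4 * ((1 + + j) * (1 + + j)) * (central² (suc j) * central² (suc m)) * ρ (1 + + m) (+ j))
           (sym (ℕP.+-suc m j)) (rhsPartial-closed (suc m) j))
    (central²-recurrence (suc m))
    (central²-recurrence m)
    (central²-recurrence (suc j))

rhs-boundary-identity :
  ∀ (n : ℕ) {Q bₙ₊₁ bₙ₊₂ x₁ x₂ x₃ : ℤ} →
  let N = + n
  in x₁ ≡ bₙ₊₁ * 1 → x₂ ≡ bₙ₊₁ * 4 → x₃ ≡ bₙ₊₂ * 1 →
     1 * Q ≡ 4 * ((1 + N) * (1 + N)) * (bₙ₊₁ * 1) * ρ 0 N →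
     (2 + N) * (2 + N) * bₙ₊₂ ≡ (2 * (1 + 2 * (1 + N))) * (2 * (1 + 2 * (1 + N))) * bₙ₊₁ →
     Q + P₁ N * x₁ + P₂ N * (x₂ + x₃) ≡ 0
rhs-boundary-identity n {Q} {bₙ₊₁} {bₙ₊₂} refl refl refl closed sₙ₊₁ =
  d*[x-y]≡0⇒x≡y ((2 + N) * (2 + N))
    (trans (certificate N Q bₙ₊₁ bₙ₊₂)
           (cong₂ _+_ (x≡y⇒q*[x-y]≡0 ((2 + N) * (2 + N)) closed)
                      (x≡y⇒q*[x-y]≡0 (P₂ N) sₙ₊₁)))
  where
  N : ℤ
  N = + n
  certificate : ∀ N Q bₙ₊₁ bₙ₊₂ →
    (2 + N) * (2 + N) * ((Q + P₁ N * (bₙ₊₁ * 1) + P₂ N * (bₙ₊₁ * 4 + bₙ₊₂ * 1)) - 0)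
    ≡ (2 + N) * (2 + N) * (1 * Q - 4 * ((1 + N) * (1 + N)) * (bₙ₊₁ * 1) * ρ 0 N)
      + P₂ N * ((2 + N) * (2 + N) * bₙ₊₂
                - (2 * (1 + 2 * (1 + N))) * (2 * (1 + 2 * (1 + N))) * bₙ₊₁)
  certificate = solve-∀

ℒ-rhs : ∀ n → ℒ rhs n ≡ 0
ℒ-rhs n = trans (ℒ-sumTo rhsTerm n)
  (rhs-boundary-identity n
    (rhsTerm-at {suc n} {suc n} (ℕP.n∸n≡0 n))
    (rhsTerm-at {2 ℕ.+ n} {suc n} (ℕP.m+n∸n≡m 1 n))
    (rhsTerm-at {2 ℕ.+ n} {2 ℕ.+ n} (ℕP.n∸n≡0 n))
    (rhsPartial-closed 0 n)
    (central²-recurrence (suc n)))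

lemma2p1 : (n : ℕ) →
    sumTo n (λ k → ((+ ((2 Data.Nat.* k) C k)) ^ 3) * (+ (k C (n ∸ k))) * ((- (+ 16)) ^ (n ∸ k)))
      ≡ sumTo n (λ k → ((+ ((2 Data.Nat.* k) C k)) ^ 2) * ((+ ((2 Data.Nat.* (n ∸ k)) C (n ∸ k))) ^ 2))
lemma2p1 = ℒ-unique ℒ-lhs ℒ-rhs refl refl
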